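{- Let $G$ be a finite connected graph of order $n$, maximum degree $\Delta$, with $\ell$ leaves, such that $C(G)\neq\emptyset$. Let $V_{o}$ be the set of vertices of odd degree. Then (i) $$\gamma_{s}(G)\geq \frac{\left(\lceil\frac{\delta^{*}}{2}\rceil-\lfloor\frac{\Delta}{2}\rfloor+1\right)n+2\lfloor\frac{\Delta}{2}\rfloor \ell}{\lceil\frac{\delta^{*}}{2}\rceil+\lfloor\frac{\Delta}{2}\rfloor+1};$$ (ii) $$\gamma_{s}(G)\geq \frac{\left(\lceil\frac{3\delta^{*}}{2}\rceil-\lfloor\frac{3\Delta}{2}\rfloor+3\right)n+2\left(\lfloor\frac{\Delta}{2}\rfloor \ell+|V_o|\right)}{\lceil\frac{3\delta^{*}}{2}\rceil+\lfloor\frac{3\Delta}{2}\rfloor+3}.$$ Moreover, both bounds are sharp: for every $n\geq 3$ equality holds in (i) and in (ii) for the complete graph $K_n$.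
   Context: A signed dominating function (SDF) of $G$ is a function $f:V(G)\to\{ -1,1\}$ with $f(N[v])=\sum_{u\in N[v]}f(u)\geq 1$ for every vertex $v$, where $N[v]$ is the closed neighborhood; $\gamma_s(G)$ is the minimum of $\sum_{v} f(v)$ over all SDFs. Let $O$ be the set of isolated vertices, $L$ the set of leaves (degree-$1$ vertices), $S$ the set of support vertices (vertices adjacent to a leaf), $C(G)=V(G)\setminus(O\cup L\cup S)$, and $\delta^{*}=\min\{\deg(v): v\in C(G)\}$. -}

module Defs where

open import Data.Nat as ℕ using (ℕ; zero; suc; ⌊_/2⌋; ⌈_/2⌉)
open import Data.Integer as ℤ using (ℤ; +_; -[1+_])
open import Data.Fin using (Fin; zero; suc; _≟_)
open import Data.Bool using (Bool; true; false; if_then_else_; not)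
open import Data.Product using (Σ; ∃; _×_; _,_)
open import Data.Sum using (_⊎_)
open import Relation.Nullary using (¬_; yes; no)
open import Relation.Nullary.Decidable using (⌊_⌋)
open import Relation.Binary.PropositionalEquality using (_≡_; refl; sym)
open import Data.Empty using (⊥-elim)

record Graph (n : ℕ) : Set where
  field
    adj    : Fin n → Fin n → Bool
    adj-sym : ∀ u v → adj u v ≡ adj v u
    adj-irr : ∀ v → adj v v ≡ false
open Graph public

countFin : ∀ {n} → (Fin n → Bool) → ℕ
countFin {zero}  p = 0
countFin {suc n} p = (if p zero then 1 else 0) ℕ.+ countFin (λ i → p (suc i))

sumFin : ∀ {n} → (Fin n → ℤ) → ℤ
sumFin {zero}  f = + 0
sumFin {suc n} f = f zero ℤ.+ sumFin (λ i → f (suc i))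

maxFin : ∀ {n} → (Fin n → ℕ) → ℕ
maxFin {zero}  f = 0
maxFin {suc n} f = f zero ℕ.⊔ maxFin (λ i → f (suc i))

module _ {n : ℕ} (G : Graph n) where

  deg : Fin n → ℕ
  deg v = countFin (adj G v)

  maxDeg : ℕ
  maxDeg = maxFin deg

  isLeafB : Fin n → Bool
  isLeafB v = ⌊ deg v ℕ.≟ 1 ⌋

  numLeaves : ℕ
  numLeaves = countFin isLeafB

  numOdd : ℕ
  numOdd = countFin (λ v → ⌊ deg v ℕ.% 2 ℕ.≟ 1 ⌋)

  Isolated Leaf Support InC : Fin n → Set
  Isolated v = deg v ≡ 0
  Leaf v = deg v ≡ 1
  Support v = ∃ λ u → adj G v u ≡ true × Leaf u
  InC v = ¬ Isolated v × ¬ Leaf v × ¬ Support v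

  IsDeltaStar : ℕ → Set
  IsDeltaStar d = (∃ λ v → InC v × deg v ≡ d) × (∀ v → InC v → d ℕ.≤ deg v)

  data Reach : Fin n → Fin n → Set where
    here : ∀ {v} → Reach v v
    step : ∀ {u w v} → adj G u w ≡ true → Reach w v → Reach u v

  Connected : Set
  Connected = ∀ u v → Reach u v

  closedSum : (Fin n → ℤ) → Fin n → ℤ
  closedSum f v = f v ℤ.+ sumFin (λ u → if adj G v u then f u else + 0)

  weight : (Fin n → ℤ) → ℤ
  weight f = sumFin f

  IsSDF : (Fin n → ℤ) → Set
  IsSDF f = (∀ v → f v ≡ + 1 ⊎ f v ≡ -[1+ 0 ]) × (∀ v → + 1 ℤ.≤ closedSum f v)

  IsSignedDomNumber : ℤ → Set
  IsSignedDomNumber γ = (∃ λ f → IsSDF f × weight f ≡ γ) × (∀ f → IsSDF f → γ ℤ.≤ weight f)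

  num1 : ℕ → ℤ
  num1 d = ((+ ⌈ d /2⌉ ℤ.- + ⌊ maxDeg /2⌋) ℤ.+ + 1) ℤ.* + n
           ℤ.+ + (2 ℕ.* ⌊ maxDeg /2⌋ ℕ.* numLeaves)
  den1 : ℕ → ℕ
  den1 d = ⌈ d /2⌉ ℕ.+ ⌊ maxDeg /2⌋ ℕ.+ 1

  num2 : ℕ → ℤ
  num2 d = ((+ ⌈ 3 ℕ.* d /2⌉ ℤ.- + ⌊ 3 ℕ.* maxDeg /2⌋) ℤ.+ + 3) ℤ.* + n
           ℤ.+ + (2 ℕ.* (⌊ maxDeg /2⌋ ℕ.* numLeaves ℕ.+ numOdd))
  den2 : ℕ → ℕ
  den2 d = ⌈ 3 ℕ.* d /2⌉ ℕ.+ ⌊ 3 ℕ.* maxDeg /2⌋ ℕ.+ 3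

private
  ≟-refl : ∀ {n} (v : Fin n) → ⌊ v ≟ v ⌋ ≡ true
  ≟-refl v with v ≟ v
  ... | yes _ = refl
  ... | no ¬p = ⊥-elim (¬p refl)

  ≟-sym : ∀ {n} (u v : Fin n) → ⌊ u ≟ v ⌋ ≡ ⌊ v ≟ u ⌋
  ≟-sym u v with u ≟ v | v ≟ u
  ... | yes _ | yes _ = refl
  ... | no _  | no _  = refl
  ... | yes p | no ¬q = ⊥-elim (¬q (sym p))
  ... | no ¬p | yes q = ⊥-elim (¬p (sym q))

K : (n : ℕ) → Graph n
K n = record
  { adj = λ u v → not ⌊ u ≟ v ⌋
  ; adj-sym = λ u v → symK u v
  ; adj-irr = λ v → irr v }
  where
  symK : ∀ u v → not ⌊ u ≟ v ⌋ ≡ not ⌊ v ≟ u ⌋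
  symK u v rewrite ≟-sym u v = refl
  irr : ∀ v → not ⌊ v ≟ v ⌋ ≡ false
  irr v rewrite ≟-refl v = refl

module Submission where

-- Let f be a signed dominating function with m vertices of value −1 and p of value +1, so that
-- n = p + m and w(f) = p − m.  At a vertex v with P(v) positive and N(v) negative neighbours,
-- f(N[v]) ≥ 1 says N(v) ≤ P(v), and N(v) + 2 ≤ P(v) if f(v) = −1.  Hence a vertex of value −1 is
-- neither isolated, nor a leaf, nor adjacent to a leaf (a leaf u has N(u) = 0), so it lies in C(G),
-- has degree at least δ*, and P(v) ≥ ⌈δ*/2⌉ + 1; at a vertex of value +1, N(v) ≤ ⌊Δ/2⌋, and
-- N(v) = 0 at a leaf.  The sum of P over the −1 vertices and the sum of N over the +1 vertices both
-- count the edges between the two classes, so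
--   m (⌈δ*/2⌉ + 1) + ℓ ⌊Δ/2⌋ ≤ p ⌊Δ/2⌋,
-- which is (i) after substituting p and m.  For (ii) the count is tripled, and the parity of deg v
-- gains one more unit at each vertex of odd degree.
-- On K_n the optimum has weight 1 or 2 according to the parity of n, and both bounds are attained.

open import Defs
open import Algebra.Bundles using (CommutativeMonoid)
open import Data.Bool using (Bool; true; false; not; _∧_; if_then_else_)
open import Data.Bool.Properties using (∧-commutativeMonoid)
open import Data.Fin using (Fin; zero; suc; toℕ; _≟_)
import Data.Integer as Int
open Int using (ℤ)
open import Data.Nat as ℕ using (ℕ; zero; suc; z≤n; s≤s; ⌊_/2⌋; ⌈_/2⌉; _%_)
open import Data.Product using (∃; _×_; _,_; proj₁; proj₂)
open import Data.Sum using (_⊎_; inj₁; inj₂)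
open import Function using (_∘_)
open import Relation.Binary.PropositionalEquality
open import Relation.Nullary using (¬_; yes; no; contradiction)
open import Relation.Nullary.Decidable using (⌊_⌋; ⌊⌋-map′)

module Counting where

  open import Data.Nat using (_+_; _*_; _≤_)
  open import Data.Nat.Properties
  open import Algebra.Properties.Semiring.Sum +-*-semiring public
    using (sum; ∑-comm; ∑-distrib-+; sum-cong-≗; *-distribˡ-sum)

  infix 8 [_]*_

  [_]*_ : Bool → ℕ → ℕ
  [ b ]* x = if b then x else 0

  countFin≡∑ : ∀ {n} (p : Fin n → Bool) → countFin p ≡ sum (λ i → [ p i ]* 1)
  countFin≡∑ {zero}  p = refl
  countFin≡∑ {suc n} p = cong (λ c → [ p zero ]* 1 + c) (countFin≡∑ (p ∘ suc))

  countFin-cong : ∀ {n} {p q : Fin n → Bool} → (∀ i → p i ≡ q i) → countFin p ≡ countFin q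
  countFin-cong {p = p} {q} p≗q = begin
    countFin p                ≡⟨ countFin≡∑ p ⟩
    sum (λ i → [ p i ]* 1)    ≡⟨ sum-cong-≗ (cong ([_]* 1) ∘ p≗q) ⟩
    sum (λ i → [ q i ]* 1)    ≡⟨ countFin≡∑ q ⟨
    countFin q                ∎
    where open ≡-Reasoning

  countFin-const : ∀ n b → countFin {n} (λ _ → b) ≡ n * [ b ]* 1
  countFin-const zero    b = refl
  countFin-const (suc n) b = cong (λ c → [ b ]* 1 + c) (countFin-const n b)

  countFin-split : ∀ {n} (h q : Fin n → Bool) →
    countFin h ≡ countFin (λ i → h i ∧ not (q i)) + countFin (λ i → h i ∧ q i)
  countFin-split {zero}  h q = refl
  countFin-split {suc n} h q with h zero | q zero | countFin-split (h ∘ suc) (q ∘ suc)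
  ... | true  | true  | ih = trans (cong suc ih) (sym (+-suc _ _))
  ... | true  | false | ih = cong suc ih
  ... | false | _     | ih = ih

  n≡countFin-not+countFin : ∀ {n} (q : Fin n → Bool) → n ≡ countFin (not ∘ q) + countFin q
  n≡countFin-not+countFin {n} q =
    trans (sym (trans (countFin-const n true) (*-identityʳ n))) (countFin-split (λ _ → true) q)

  1≤countFin : ∀ {n} (p : Fin n → Bool) {i} → p i ≡ true → 1 ≤ countFin p
  1≤countFin p {zero}  pi≡true rewrite pi≡true = s≤s z≤n
  1≤countFin p {suc i} pi≡true =
    ≤-trans (1≤countFin (p ∘ suc) pi≡true) (m≤n+m _ ([ p zero ]* 1))

  []*-countFin : ∀ {n} b (p : Fin n → Bool) → [ b ]* countFin p ≡ countFin (λ i → b ∧ p i)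
  []*-countFin true  p = refl
  []*-countFin {n} false p = sym (trans (countFin-const n false) (*-zeroʳ n))

  ∑[]*-const : ∀ {n} (q : Fin n → Bool) c → sum (λ i → [ q i ]* c) ≡ countFin q * c
  ∑[]*-const {zero}  q c = refl
  ∑[]*-const {suc n} q c with q zero
  ... | true  = cong (_+_ c) (∑[]*-const (q ∘ suc) c)
  ... | false = ∑[]*-const (q ∘ suc) c

  ∑-mono-≤ : ∀ {n} {g h : Fin n → ℕ} → (∀ i → g i ≤ h i) → sum g ≤ sum h
  ∑-mono-≤ {zero}  g≤h = z≤n
  ∑-mono-≤ {suc n} g≤h = +-mono-≤ (g≤h zero) (∑-mono-≤ (g≤h ∘ suc))

  ≤-maxFin : ∀ {n} (g : Fin n → ℕ) i → g i ≤ maxFin g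
  ≤-maxFin g zero    = m≤m⊔n _ _
  ≤-maxFin g (suc i) = ≤-trans (≤-maxFin (g ∘ suc) i) (m≤n⊔m (g zero) _)

  maxFin-const : ∀ {n} {g : Fin (suc n) → ℕ} {c} → (∀ i → g i ≡ c) → maxFin g ≡ c
  maxFin-const {zero}  g≗c rewrite g≗c zero = ⊔-identityʳ _
  maxFin-const {suc n} g≗c rewrite g≗c zero | maxFin-const (g≗c ∘ suc) = ⊔-idem _

open Counting

module LocalBounds where

  open import Data.Nat using (_+_; _*_; _≤_)
  open import Data.Nat.Properties
  open import Data.Nat.DivMod using (m%n<n; [m+kn]%n≡m%n)
  import Data.Nat.Tactic.RingSolver as ℕ-Solver
  open ≤-Reasoning

  m≤n+n⇒⌈m/2⌉≤n : ∀ {m n} → m ≤ n + n → ⌈ m /2⌉ ≤ n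
  m≤n+n⇒⌈m/2⌉≤n {m} {n} m≤2n = ≤-trans (⌈n/2⌉-mono m≤2n) (≤-reflexive (sym (n≡⌈n+n/2⌉ n)))

  m+m≤n⇒m≤⌊n/2⌋ : ∀ {m n} → m + m ≤ n → m ≤ ⌊ n /2⌋
  m+m≤n⇒m≤⌊n/2⌋ {m} 2m≤n = ≤-trans (≤-reflexive (n≡⌊n+n/2⌋ m)) (⌊n/2⌋-mono 2m≤n)

  ⌈n+n+m/2⌉≡n+⌈m/2⌉ : ∀ n m → ⌈ n + n + m /2⌉ ≡ n + ⌈ m /2⌉
  ⌈n+n+m/2⌉≡n+⌈m/2⌉ zero    m = refl
  ⌈n+n+m/2⌉≡n+⌈m/2⌉ (suc n) m rewrite +-suc n n = cong suc (⌈n+n+m/2⌉≡n+⌈m/2⌉ n m)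

  ⌈n/2⌉≡⌊n/2⌋+n%2 : ∀ n → ⌈ n /2⌉ ≡ ⌊ n /2⌋ + n % 2
  ⌈n/2⌉≡⌊n/2⌋+n%2 zero          = refl
  ⌈n/2⌉≡⌊n/2⌋+n%2 (suc zero)    = refl
  ⌈n/2⌉≡⌊n/2⌋+n%2 (suc (suc n)) = cong suc (⌈n/2⌉≡⌊n/2⌋+n%2 n)

  [n+n]%2≡0 : ∀ n → (n + n) % 2 ≡ 0
  [n+n]%2≡0 zero    = refl
  [n+n]%2≡0 (suc n) rewrite +-suc n n = [n+n]%2≡0 n

  [m+2+n]%2≡[m+n]%2 : ∀ m n → (m + suc (suc n)) % 2 ≡ (m + n) % 2
  [m+2+n]%2≡[m+n]%2 m n = cong (_% 2) (trans (+-suc m (suc n)) (cong suc (+-suc m n)))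

  [3n]%2≡n%2 : ∀ n → (3 * n) % 2 ≡ n % 2
  [3n]%2≡n%2 n = trans (cong (_% 2) (3n≡n+n*2 n)) ([m+kn]%n≡m%n n n 2)
    where
    3n≡n+n*2 : ∀ n → 3 * n ≡ n + n * 2
    3n≡n+n*2 = ℕ-Solver.solve-∀

  [⌊n%2≟1⌋]*1≡n%2 : ∀ n → [ ⌊ n % 2 ℕ.≟ 1 ⌋ ]* 1 ≡ n % 2
  [⌊n%2≟1⌋]*1≡n%2 n with n % 2 | m%n<n n 2
  ... | 0           | _               = refl
  ... | 1           | _               = refl
  ... | suc (suc _) | s≤s (s≤s ())

  m≤n⇒[n+m]%2+m≤n : ∀ {m n} → m ≤ n → (n + m) % 2 + m ≤ n
  m≤n⇒[n+m]%2+m≤n {m} {n} m≤n with m≤n⇒m<n∨m≡n m≤n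
  ... | inj₁ m<n  = ≤-trans (+-monoˡ-≤ m (≤-pred (m%n<n (n + m) 2))) m<n
  ... | inj₂ refl = ≤-reflexive (cong (_+ m) ([n+n]%2≡0 m))

  -- The condition f(N[v]) ≥ 1 at a vertex v with P positive and N negative neighbours;
  -- the flag is true when f(v) = −1.
  Dominated : Bool → ℕ → ℕ → Set
  Dominated false P N = N ≤ P
  Dominated true  P N = 2 + N ≤ P

  dominated-leaf : ∀ s {P N} → Dominated s P N → P + N ≡ 1 → s ≡ false × N ≡ 0
  dominated-leaf true  {P} {N} 2+N≤P P+N≡1 =
    contradiction (≤-trans (m≤m+n 2 N) (≤-trans 2+N≤P (m≤m+n P N))) (<-irrefl (sym P+N≡1))
  dominated-leaf false {P} {zero}  _         _     = refl , refl
  dominated-leaf false {suc P} {suc N} _ P+N≡1 =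
    contradiction (trans (sym (+-suc P N)) (suc-injective P+N≡1)) (λ ())

  negative-bound₁ : ∀ {P N d} → 2 + N ≤ P → d ≤ P + N → suc ⌈ d /2⌉ ≤ P
  negative-bound₁ {P} {N} {d} 2+N≤P d≤P+N = m≤n+n⇒⌈m/2⌉≤n (begin
    2 + d         ≤⟨ +-monoʳ-≤ 2 d≤P+N ⟩
    2 + (P + N)   ≡⟨ +-comm 2 (P + N) ⟩
    (P + N) + 2   ≡⟨ +-assoc P N 2 ⟩
    P + (N + 2)   ≡⟨ cong (P +_) (+-comm N 2) ⟩
    P + (2 + N)   ≤⟨ +-monoʳ-≤ P 2+N≤P ⟩
    P + P         ∎)

  positive-bound₁ : ∀ {P N Δ} → N ≤ P → P + N ≤ Δ → N ≤ ⌊ Δ /2⌋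
  positive-bound₁ {P} {N} N≤P P+N≤Δ = m+m≤n⇒m≤⌊n/2⌋ (≤-trans (+-monoˡ-≤ N N≤P) P+N≤Δ)

  negative-bound₂ : ∀ {P N d} → 2 + N ≤ P → d ≤ P + N → 3 + (⌈ 3 * d /2⌉ + (P + N) % 2) ≤ 3 * P
  negative-bound₂ {P} {N} {d} 2+N≤P d≤P+N = begin
    3 + (⌈ 3 * d /2⌉ + r)           ≡⟨ cong (3 +_) (+-comm _ r) ⟩
    (3 + r) + ⌈ 3 * d /2⌉           ≡⟨ ⌈n+n+m/2⌉≡n+⌈m/2⌉ (3 + r) (3 * d) ⟨
    ⌈ (3 + r) + (3 + r) + 3 * d /2⌉  ≤⟨ m≤n+n⇒⌈m/2⌉≤n twice ⟩
    3 * P                           ∎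
    where
    r = (P + N) % 2
    parity : r + (2 + N) ≤ P
    parity = subst (λ x → x + (2 + N) ≤ P) ([m+2+n]%2≡[m+n]%2 P N) (m≤n⇒[n+m]%2+m≤n 2+N≤P)
    rearrange : ∀ r P N → (3 + r) + (3 + r) + 3 * (P + N) + r ≡ 3 * (r + (2 + N)) + 3 * P
    rearrange = ℕ-Solver.solve-∀
    twice : (3 + r) + (3 + r) + 3 * d ≤ 3 * P + 3 * P
    twice = begin
      (3 + r) + (3 + r) + 3 * d             ≤⟨ +-monoʳ-≤ ((3 + r) + (3 + r)) (*-monoʳ-≤ 3 d≤P+N) ⟩
      (3 + r) + (3 + r) + 3 * (P + N)       ≤⟨ m≤m+n _ r ⟩
      (3 + r) + (3 + r) + 3 * (P + N) + r   ≡⟨ rearrange r P N ⟩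
      3 * (r + (2 + N)) + 3 * P             ≤⟨ +-monoˡ-≤ (3 * P) (*-monoʳ-≤ 3 parity) ⟩
      3 * P + 3 * P                         ∎

  positive-bound₂ : ∀ {P N Δ} → N ≤ P → P + N ≤ Δ → 3 * N + (P + N) % 2 ≤ ⌊ 3 * Δ /2⌋
  positive-bound₂ {P} {N} {Δ} N≤P P+N≤Δ = m+m≤n⇒m≤⌊n/2⌋ (begin
    (3 * N + r) + (3 * N + r)        ≤⟨ m≤m+n _ r ⟩
    (3 * N + r) + (3 * N + r) + r    ≡⟨ rearrange N r ⟩
    3 * (r + N + N)                  ≤⟨ *-monoʳ-≤ 3 (+-monoˡ-≤ N (m≤n⇒[n+m]%2+m≤n N≤P)) ⟩
    3 * (P + N)                      ≤⟨ *-monoʳ-≤ 3 P+N≤Δ ⟩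
    3 * Δ                            ∎)
    where
    r = (P + N) % 2
    rearrange : ∀ N r → (3 * N + r) + (3 * N + r) + r ≡ 3 * (r + N + N)
    rearrange = ℕ-Solver.solve-∀

  leaf-bound₂ : ∀ {Δ} → 1 ≤ Δ → suc ⌊ Δ /2⌋ ≤ ⌊ 3 * Δ /2⌋
  leaf-bound₂ {suc e} _ = ⌊n/2⌋-mono (begin
    3 + e                ≤⟨ +-monoʳ-≤ 3 (m≤m+n e (e + e)) ⟩
    3 + (e + (e + e))    ≡⟨ expand e ⟨
    3 * suc e            ∎)
    where
    expand : ∀ e → 3 * suc e ≡ 3 + (e + (e + e))
    expand = ℕ-Solver.solve-∀

  vertex-bound₁ : ∀ s {P N D d Δ} → D ≡ P + N → Dominated s P N → (s ≡ true → d ≤ D) → D ≤ Δ →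
    [ s ]* suc ⌈ d /2⌉ + [ ⌊ D ℕ.≟ 1 ⌋ ]* ⌊ Δ /2⌋ + [ not s ]* N ≤ [ not s ]* ⌊ Δ /2⌋ + [ s ]* P
  vertex-bound₁ true  {P} {N} refl dom d≤D _ with P + N ℕ.≟ 1
  ... | yes D≡1 = contradiction (proj₁ (dominated-leaf true dom D≡1)) (λ ())
  ... | no  _   =
    ≤-trans (≤-reflexive (trans (+-identityʳ _) (+-identityʳ _))) (negative-bound₁ dom (d≤D refl))
  vertex-bound₁ false {P} {N} refl dom _ D≤Δ with P + N ℕ.≟ 1
  ... | yes D≡1 rewrite proj₂ (dominated-leaf false dom D≡1) = ≤-refl
  ... | no  _   = ≤-trans (positive-bound₁ dom D≤Δ) (m≤m+n _ 0)

  vertex-bound₂ : ∀ s {P N D d Δ} → D ≡ P + N → Dominated s P N → (s ≡ true → d ≤ D) → D ≤ Δ →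
    [ s ]* (3 + ⌈ 3 * d /2⌉) + D % 2 + [ ⌊ D ℕ.≟ 1 ⌋ ]* ⌊ Δ /2⌋ + 3 * [ not s ]* N
      ≤ [ not s ]* ⌊ 3 * Δ /2⌋ + 3 * [ s ]* P
  vertex-bound₂ true  {P} {N} refl dom d≤D _ with P + N ℕ.≟ 1
  ... | yes D≡1 = contradiction (proj₁ (dominated-leaf true dom D≡1)) (λ ())
  ... | no  _   =
    ≤-trans (≤-reflexive (trans (+-identityʳ _) (+-identityʳ _))) (negative-bound₂ dom (d≤D refl))
  vertex-bound₂ false {P} {N} {Δ = Δ} refl dom _ D≤Δ with P + N ℕ.≟ 1
  ... | yes D≡1 rewrite D≡1 | proj₂ (dominated-leaf false dom D≡1) =
    +-monoˡ-≤ 0 (leaf-bound₂ D≤Δ)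
  ... | no  _   = begin
    (P + N) % 2 + 0 + 3 * N   ≡⟨ cong (_+ 3 * N) (+-identityʳ ((P + N) % 2)) ⟩
    (P + N) % 2 + 3 * N       ≡⟨ +-comm _ (3 * N) ⟩
    3 * N + (P + N) % 2       ≤⟨ positive-bound₂ dom D≤Δ ⟩
    ⌊ 3 * Δ /2⌋               ≤⟨ m≤m+n _ 0 ⟩
    ⌊ 3 * Δ /2⌋ + 0           ∎

open LocalBounds

module Neighbourhoods {n} (G : Graph n) where

  open import Algebra.Properties.CommutativeSemigroup
    (CommutativeMonoid.commutativeSemigroup ∧-commutativeMonoid) using (x∙yz≈z∙yx)

  degIn : (Fin n → Bool) → Fin n → ℕ
  degIn q v = countFin (λ w → adj G v w ∧ q w)

  deg≡degIn+degIn : ∀ q v → deg G v ≡ degIn (not ∘ q) v ℕ.+ degIn q v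
  deg≡degIn+degIn q v = countFin-split (adj G v) q

  -- Both sides count the edges between q and r.
  ∑-degIn-comm : ∀ q r → sum (λ v → [ q v ]* degIn r v) ≡ sum (λ v → [ r v ]* degIn q v)
  ∑-degIn-comm q r = begin
    sum (λ v → [ q v ]* degIn r v)      ≡⟨ sum-cong-≗ (expand q r) ⟩
    sum (λ v → sum (λ w → edge q r v w)) ≡⟨ ∑-comm (edge q r) ⟩
    sum (λ w → sum (λ v → edge q r v w)) ≡⟨ sum-cong-≗ (λ w → sum-cong-≗ (λ v → edge-sym v w)) ⟩
    sum (λ w → sum (λ v → edge r q w v)) ≡⟨ sum-cong-≗ (expand r q) ⟨
    sum (λ w → [ r w ]* degIn q w)      ∎
    where
    open ≡-Reasoning
    edge : (Fin n → Bool) → (Fin n → Bool) → Fin n → Fin n → ℕ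
    edge q r v w = [ q v ∧ (adj G v w ∧ r w) ]* 1
    expand : ∀ q r v → [ q v ]* degIn r v ≡ sum (edge q r v)
    expand q r v =
      trans ([]*-countFin (q v) (λ w → adj G v w ∧ r w)) (countFin≡∑ (λ w → q v ∧ (adj G v w ∧ r w)))
    edge-sym : ∀ v w → edge q r v w ≡ edge r q w v
    edge-sym v w rewrite adj-sym G v w = cong ([_]* 1) (x∙yz≈z∙yx (q v) (adj G w v) (r w))

open Neighbourhoods

module SignedSums where

  open Int using (+_; -[1+_]; +≤+; _+_; _-_; -_; _≤_)
  open import Data.Integer.Properties
    using (≤-trans; ≤-reflexive; +-monoˡ-≤; +-identityˡ; +-assoc; drop‿+≤+)
  import Data.Integer.Tactic.RingSolver as ℤ-Solver

  isNegative : ℤ → Bool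
  isNegative (+ _)    = false
  isNegative -[1+ _ ] = true

  sign-step : ∀ {x} → x ≡ + 1 ⊎ x ≡ -[1+ 0 ] → ∀ P N →
    x + (+ P - + N) ≡ + ([ not (isNegative x) ]* 1 ℕ.+ P) - + ([ isNegative x ]* 1 ℕ.+ N)
  sign-step (inj₁ refl) P N = sym (+-assoc (+ 1) (+ P) (- + N))
  sign-step (inj₂ refl) P N = shift (+ P) (+ N)
    where
    shift : ∀ x y → - + 1 + (x - y) ≡ x - (+ 1 + y)
    shift = ℤ-Solver.solve-∀

  ∑-signs : ∀ {n} (h : Fin n → Bool) (f : Fin n → ℤ) → (∀ u → f u ≡ + 1 ⊎ f u ≡ -[1+ 0 ]) →
    sumFin (λ u → if h u then f u else + 0)
      ≡ + countFin (λ u → h u ∧ not (isNegative (f u))) - + countFin (λ u → h u ∧ isNegative (f u))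
  ∑-signs {zero}  h f ±1 = refl
  ∑-signs {suc n} h f ±1 with h zero
  ... | false = trans (+-identityˡ _) (∑-signs (h ∘ suc) (f ∘ suc) (±1 ∘ suc))
  ... | true  =
    trans (cong (_+_ (f zero)) (∑-signs (h ∘ suc) (f ∘ suc) (±1 ∘ suc))) (sign-step (±1 zero) _ _)

  i≤j+k⇒i-j≤k : ∀ {i j k} → i ≤ j + k → i - j ≤ k
  i≤j+k⇒i-j≤k {i} {j} {k} i≤j+k = ≤-trans (+-monoˡ-≤ (- j) i≤j+k) (≤-reflexive (cancel j k))
    where
    cancel : ∀ j k → j + k - j ≡ k
    cancel = ℤ-Solver.solve-∀

  k≤m-n⇒k+n≤m : ∀ {k m n} → + k ≤ + m - + n → k ℕ.+ n ℕ.≤ m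
  k≤m-n⇒k+n≤m {k} {m} {n} k≤m-n =
    drop‿+≤+ (≤-trans (+-monoˡ-≤ (+ n) k≤m-n) (≤-reflexive (cancel (+ m) (+ n))))
    where
    cancel : ∀ m n → m - n + n ≡ m
    cancel = ℤ-Solver.solve-∀

  k+n≤m⇒k≤m-n : ∀ {k m n} → k ℕ.+ n ℕ.≤ m → + k ≤ + m - + n
  k+n≤m⇒k≤m-n {k} {m} {n} k+n≤m =
    ≤-trans (≤-reflexive (sym (cancel (+ k) (+ n)))) (+-monoˡ-≤ (- + n) (+≤+ k+n≤m))
    where
    cancel : ∀ k n → k + n - n ≡ k
    cancel = ℤ-Solver.solve-∀

  dominated : ∀ {x P N} → x ≡ + 1 ⊎ x ≡ -[1+ 0 ] → + 1 ≤ x + (+ P - + N) →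
    Dominated (isNegative x) P N
  dominated (inj₁ refl) 1≤ = k≤m-n⇒k+n≤m {0} (i≤j+k⇒i-j≤k {j = + 1} 1≤)
  dominated (inj₂ refl) 1≤ = k≤m-n⇒k+n≤m {2} (i≤j+k⇒i-j≤k {j = -[1+ 0 ]} 1≤)

  weight-signs : ∀ {n} (f : Fin n → ℤ) → (∀ u → f u ≡ + 1 ⊎ f u ≡ -[1+ 0 ]) →
    sumFin f ≡ + countFin (not ∘ isNegative ∘ f) - + countFin (isNegative ∘ f)
  weight-signs f ±1 = ∑-signs (λ _ → true) f ±1

  sdf-dominated : ∀ {n} (G : Graph n) {f} → IsSDF G f → ∀ v →
    Dominated (isNegative (f v)) (degIn G (not ∘ isNegative ∘ f) v) (degIn G (isNegative ∘ f) v)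
  sdf-dominated G {f} (±1 , closedSum≥1) v =
    dominated (±1 v) (subst (λ x → + 1 ≤ x) (cong (_+_ (f v)) (∑-signs (adj G v) f ±1))
                            (closedSum≥1 v))

open SignedSums

module Bounds where

  open Int using (+_; +≤+; _+_; _-_; _*_; _≤_)
  open import Data.Integer.Properties
    using (≤-trans; ≤-reflexive; +-monoʳ-≤; +-identityʳ; i≤j⇒0≤j-i; *-monoˡ-≤-nonNeg; pos-*)
  import Data.Integer.Tactic.RingSolver as ℤ-Solver

  ≤-by-slack : ∀ {x y l r} → x ≤ y → r ≡ l + + 2 * (y - x) → l ≤ r
  ≤-by-slack {x} {y} {l} x≤y refl = ≤-trans (≤-reflexive (sym (+-identityʳ l)))
    (+-monoʳ-≤ l (*-monoˡ-≤-nonNeg (+ 2) (i≤j⇒0≤j-i x≤y)))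

  counting⇒bound₁ : ∀ a b p m l {n} → n ≡ p ℕ.+ m → m ℕ.* suc a ℕ.+ l ℕ.* b ℕ.≤ p ℕ.* b →
    ((+ a - + b) + + 1) * + n + + (2 ℕ.* b ℕ.* l) ≤ (+ p - + m) * + (a ℕ.+ b ℕ.+ 1)
  counting⇒bound₁ a b p m l refl counting = ≤-by-slack (+≤+ counting) (begin
    (+ p - + m) * + (a ℕ.+ b ℕ.+ 1)
      ≡⟨ ring (+ a) (+ b) (+ p) (+ m) (+ l) ⟩
    ((+ a - + b) + + 1) * + (p ℕ.+ m) + + 2 * + b * + l
      + + 2 * (+ p * + b - (+ m * + suc a + + l * + b))
      ≡⟨ cong₂ (λ u v → ((+ a - + b) + + 1) * + (p ℕ.+ m) + u + + 2 * v)
               (trans (pos-* (2 ℕ.* b) l) (cong (_* + l) (pos-* 2 b)))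
               (cong₂ _-_ (pos-* p b) (cong₂ _+_ (pos-* m (suc a)) (pos-* l b))) ⟨
    ((+ a - + b) + + 1) * + (p ℕ.+ m) + + (2 ℕ.* b ℕ.* l)
      + + 2 * (+ (p ℕ.* b) - + (m ℕ.* suc a ℕ.+ l ℕ.* b)) ∎)
    where
    open ≡-Reasoning
    ring : ∀ a b p m l →
      (p - m) * (a + b + + 1)
        ≡ ((a - b) + + 1) * (p + m) + + 2 * b * l + + 2 * (p * b - (m * (+ 1 + a) + l * b))
    ring = ℤ-Solver.solve-∀

  counting⇒bound₂ : ∀ A B b p m l o {n} → n ≡ p ℕ.+ m →
    m ℕ.* (3 ℕ.+ A) ℕ.+ o ℕ.+ l ℕ.* b ℕ.≤ p ℕ.* B →
    ((+ A - + B) + + 3) * + n + + (2 ℕ.* (b ℕ.* l ℕ.+ o)) ≤ (+ p - + m) * + (A ℕ.+ B ℕ.+ 3)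
  counting⇒bound₂ A B b p m l o refl counting = ≤-by-slack (+≤+ counting) (begin
    (+ p - + m) * + (A ℕ.+ B ℕ.+ 3)
      ≡⟨ ring (+ A) (+ B) (+ b) (+ p) (+ m) (+ l) (+ o) ⟩
    ((+ A - + B) + + 3) * + (p ℕ.+ m) + + 2 * (+ b * + l + + o)
      + + 2 * (+ p * + B - (+ m * + (3 ℕ.+ A) + + o + + l * + b))
      ≡⟨ cong₂ (λ u v → ((+ A - + B) + + 3) * + (p ℕ.+ m) + u + + 2 * v)
               (trans (pos-* 2 (b ℕ.* l ℕ.+ o)) (cong (λ x → + 2 * (x + + o)) (pos-* b l)))
               (cong₂ _-_ (pos-* p B)
                          (cong₂ (λ u v → u + + o + v) (pos-* m (3 ℕ.+ A)) (pos-* l b))) ⟨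
    ((+ A - + B) + + 3) * + (p ℕ.+ m) + + (2 ℕ.* (b ℕ.* l ℕ.+ o))
      + + 2 * (+ (p ℕ.* B) - + (m ℕ.* (3 ℕ.+ A) ℕ.+ o ℕ.+ l ℕ.* b)) ∎)
    where
    open ≡-Reasoning
    ring : ∀ A B b p m l o →
      (p - m) * (A + B + + 3)
        ≡ ((A - B) + + 3) * (p + m) + + 2 * (b * l + o) + + 2 * (p * B - (m * (+ 3 + A) + o + l * b))
    ring = ℤ-Solver.solve-∀

open Bounds

module SignedDominatingFunction {n} (G : Graph n) (f : Fin n → ℤ) (sdf : IsSDF G f) where

  open import Data.Nat using (_+_; _*_; _≤_)
  open import Data.Nat.Properties
  open ≤-Reasoning

  σ : Fin n → Bool
  σ = isNegative ∘ f

  positiveNbrs negativeNbrs : Fin n → ℕ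
  positiveNbrs = degIn G (not ∘ σ)
  negativeNbrs = degIn G σ

  dom : ∀ v → Dominated (σ v) (positiveNbrs v) (negativeNbrs v)
  dom = sdf-dominated G sdf

  deg≡P+N : ∀ v → deg G v ≡ positiveNbrs v + negativeNbrs v
  deg≡P+N = deg≡degIn+degIn G σ

  leaf-dominated : ∀ v → Leaf G v → σ v ≡ false × negativeNbrs v ≡ 0
  leaf-dominated v leaf = dominated-leaf (σ v) (dom v) (trans (sym (deg≡P+N v)) leaf)

  negative⇒InC : ∀ v → σ v ≡ true → InC G v
  negative⇒InC v neg = not-isolated , not-leaf , not-support
    where
    2+N≤P : 2 + negativeNbrs v ≤ positiveNbrs v
    2+N≤P = subst (λ s → Dominated s (positiveNbrs v) (negativeNbrs v)) neg (dom v)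
    2≤deg : 2 ≤ deg G v
    2≤deg = begin
      2                                ≤⟨ m≤m+n 2 _ ⟩
      2 + negativeNbrs v               ≤⟨ 2+N≤P ⟩
      positiveNbrs v                   ≤⟨ m≤m+n _ _ ⟩
      positiveNbrs v + negativeNbrs v  ≡⟨ deg≡P+N v ⟨
      deg G v                          ∎
    not-isolated : ¬ Isolated G v
    not-isolated deg≡0 = contradiction (subst (2 ≤_) deg≡0 2≤deg) λ ()
    not-leaf : ¬ Leaf G v
    not-leaf leaf = contradiction (trans (sym neg) (proj₁ (leaf-dominated v leaf))) λ ()
    not-support : ¬ Support G v
    not-support (u , vu , leaf) = contradiction (subst (1 ≤_) (proj₂ (leaf-dominated u leaf)) 1≤N) λ ()
      where
      uv : adj G u v ∧ σ v ≡ true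
      uv rewrite adj-sym G u v | vu | neg = refl
      1≤N : 1 ≤ negativeNbrs u
      1≤N = 1≤countFin (λ w → adj G u w ∧ σ w) uv

  positives negatives : ℕ
  positives = countFin (not ∘ σ)
  negatives = countFin σ

  crossEdges : ℕ
  crossEdges = sum (λ v → [ σ v ]* positiveNbrs v)

  crossEdges≡ : crossEdges ≡ sum (λ v → [ not (σ v) ]* negativeNbrs v)
  crossEdges≡ = ∑-degIn-comm G σ (not ∘ σ)

  module _ (d : ℕ) (d≤deg : ∀ v → InC G v → d ≤ deg G v) where

    private
      negative⇒d≤deg : ∀ v → σ v ≡ true → d ≤ deg G v
      negative⇒d≤deg v = d≤deg v ∘ negative⇒InC v

    counting₁ : negatives * suc ⌈ d /2⌉ + numLeaves G * ⌊ maxDeg G /2⌋ ≤ positives * ⌊ maxDeg G /2⌋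
    counting₁ = +-cancelʳ-≤ crossEdges _ _ (begin
      negatives * a + numLeaves G * b + crossEdges
        ≡⟨ cong₂ _+_ (cong₂ _+_ (∑[]*-const σ a) (∑[]*-const (isLeafB G) b)) (sym crossEdges≡) ⟨
      sum charge + sum leaf + sum excess
        ≡⟨ cong (_+ sum excess) (∑-distrib-+ charge leaf) ⟨
      sum (λ v → charge v + leaf v) + sum excess
        ≡⟨ ∑-distrib-+ (λ v → charge v + leaf v) excess ⟨
      sum (λ v → charge v + leaf v + excess v)
        ≤⟨ ∑-mono-≤ vertex ⟩
      sum (λ v → [ not (σ v) ]* b + [ σ v ]* positiveNbrs v)
        ≡⟨ ∑-distrib-+ (λ v → [ not (σ v) ]* b) (λ v → [ σ v ]* positiveNbrs v) ⟩
      sum (λ v → [ not (σ v) ]* b) + crossEdges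
        ≡⟨ cong (_+ crossEdges) (∑[]*-const (not ∘ σ) b) ⟩
      positives * b + crossEdges ∎)
      where
      a b : ℕ
      a = suc ⌈ d /2⌉
      b = ⌊ maxDeg G /2⌋
      charge leaf excess : Fin n → ℕ
      charge v = [ σ v ]* a
      leaf   v = [ isLeafB G v ]* b
      excess v = [ not (σ v) ]* negativeNbrs v
      vertex : ∀ v → charge v + leaf v + excess v ≤ [ not (σ v) ]* b + [ σ v ]* positiveNbrs v
      vertex v = vertex-bound₁ (σ v) (deg≡P+N v) (dom v) (negative⇒d≤deg v) (≤-maxFin (deg G) v)

    counting₂ : negatives * (3 + ⌈ 3 * d /2⌉) + numOdd G + numLeaves G * ⌊ maxDeg G /2⌋
                ≤ positives * ⌊ 3 * maxDeg G /2⌋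
    counting₂ = +-cancelʳ-≤ (3 * crossEdges) _ _ (begin
      negatives * A + numOdd G + numLeaves G * b + 3 * crossEdges
        ≡⟨ cong₂ _+_ (cong₂ _+_ (cong₂ _+_ (∑[]*-const σ A) (sym numOdd≡∑)) (∑[]*-const (isLeafB G) b))
                     (trans (sym (*-distribˡ-sum 3 excess)) (cong (3 *_) (sym crossEdges≡))) ⟨
      sum charge + sum odd + sum leaf + sum (λ v → 3 * excess v)
        ≡⟨ cong (λ x → x + sum leaf + sum (λ v → 3 * excess v)) (∑-distrib-+ charge odd) ⟨
      sum (λ v → charge v + odd v) + sum leaf + sum (λ v → 3 * excess v)
        ≡⟨ cong (_+ sum (λ v → 3 * excess v)) (∑-distrib-+ (λ v → charge v + odd v) leaf) ⟨
      sum (λ v → charge v + odd v + leaf v) + sum (λ v → 3 * excess v)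
        ≡⟨ ∑-distrib-+ (λ v → charge v + odd v + leaf v) (λ v → 3 * excess v) ⟨
      sum (λ v → charge v + odd v + leaf v + 3 * excess v)
        ≤⟨ ∑-mono-≤ vertex ⟩
      sum (λ v → [ not (σ v) ]* B + 3 * [ σ v ]* positiveNbrs v)
        ≡⟨ ∑-distrib-+ (λ v → [ not (σ v) ]* B) (λ v → 3 * [ σ v ]* positiveNbrs v) ⟩
      sum (λ v → [ not (σ v) ]* B) + sum (λ v → 3 * [ σ v ]* positiveNbrs v)
        ≡⟨ cong₂ _+_ (∑[]*-const (not ∘ σ) B) (sym (*-distribˡ-sum 3 (λ v → [ σ v ]* positiveNbrs v))) ⟩
      positives * B + 3 * crossEdges ∎)
      where
      A b B : ℕ
      A = 3 + ⌈ 3 * d /2⌉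
      b = ⌊ maxDeg G /2⌋
      B = ⌊ 3 * maxDeg G /2⌋
      charge odd leaf excess : Fin n → ℕ
      charge v = [ σ v ]* A
      odd    v = deg G v % 2
      leaf   v = [ isLeafB G v ]* b
      excess v = [ not (σ v) ]* negativeNbrs v
      vertex : ∀ v → charge v + odd v + leaf v + 3 * excess v
                     ≤ [ not (σ v) ]* B + 3 * [ σ v ]* positiveNbrs v
      vertex v = vertex-bound₂ (σ v) (deg≡P+N v) (dom v) (negative⇒d≤deg v) (≤-maxFin (deg G) v)
      numOdd≡∑ : numOdd G ≡ sum odd
      numOdd≡∑ =
        trans (countFin≡∑ (λ v → ⌊ deg G v % 2 ℕ.≟ 1 ⌋)) (sum-cong-≗ ([⌊n%2≟1⌋]*1≡n%2 ∘ deg G))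

module CompleteGraph where

  open Int using (+_; -[1+_]; +≤+; _+_; _-_; _*_; _≤_)
  open import Data.Integer.Properties using (+-identityˡ; +-assoc; pos-*; +-commutativeSemigroup)
  open import Algebra.Properties.CommutativeSemigroup +-commutativeSemigroup using (x∙yz≈y∙xz)
  import Data.Integer.Tactic.RingSolver as ℤ-Solver
  import Data.Nat.Properties as ℕ
  import Data.Fin.Properties as Fin

  ⌊suc≟suc⌋ : ∀ {n} (v u : Fin n) → ⌊ suc v ≟ suc u ⌋ ≡ ⌊ v ≟ u ⌋
  ⌊suc≟suc⌋ v u = ⌊⌋-map′ (cong suc) Fin.suc-injective (v ≟ u)

  deg-K : ∀ k v → deg (K (suc k)) v ≡ k
  deg-K k       zero    = trans (countFin-const k true) (ℕ.*-identityʳ k)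
  deg-K (suc k) (suc v) = cong suc (trans (countFin-cong (cong not ∘ ⌊suc≟suc⌋ v)) (deg-K k v))

  maxDeg-K : ∀ k → maxDeg (K (suc k)) ≡ k
  maxDeg-K k = maxFin-const (deg-K k)

  numLeaves-K : ∀ k → numLeaves (K (3 ℕ.+ k)) ≡ 0
  numLeaves-K k = trans (countFin-cong (cong (λ x → ⌊ x ℕ.≟ 1 ⌋) ∘ deg-K (2 ℕ.+ k)))
                        (trans (countFin-const (3 ℕ.+ k) false) (ℕ.*-zeroʳ (3 ℕ.+ k)))

  numOdd-K : ∀ k → numOdd (K (suc k)) ≡ suc k ℕ.* (k % 2)
  numOdd-K k = trans (countFin-cong (cong (λ x → ⌊ x % 2 ℕ.≟ 1 ⌋) ∘ deg-K k))
                     (trans (countFin-const (suc k) _) (cong (suc k ℕ.*_) ([⌊n%2≟1⌋]*1≡n%2 k)))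

  InC-K : ∀ k v → InC (K (3 ℕ.+ k)) v
  InC-K k v = (λ deg≡0 → contradiction (trans (sym (deg-K _ v)) deg≡0) λ ())
            , not-leaf v
            , λ { (u , _ , leaf) → not-leaf u leaf }
    where
    not-leaf : ∀ u → ¬ Leaf (K (3 ℕ.+ k)) u
    not-leaf u deg≡1 = contradiction (trans (sym (deg-K _ u)) deg≡1) λ ()

  δ*-K : ∀ k → IsDeltaStar (K (3 ℕ.+ k)) (2 ℕ.+ k)
  δ*-K k = (zero , InC-K k zero , deg-K _ zero) , λ v _ → ℕ.≤-reflexive (sym (deg-K _ v))

  closedSum-K : ∀ {n} (f : Fin n → ℤ) v → closedSum (K n) f v ≡ weight (K n) f
  closedSum-K {suc n} f zero    = cong (_+_ (f zero)) (+-identityˡ _)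
  closedSum-K {suc n} f (suc v) = begin
    f (suc v) + (f zero + sumFin (λ u → if not ⌊ suc v ≟ suc u ⌋ then f (suc u) else + 0))
      ≡⟨ cong (λ x → f (suc v) + (f zero + x)) (sumFin-cong (λ u →
           cong (λ b → if not b then f (suc u) else + 0) (⌊suc≟suc⌋ v u))) ⟩
    f (suc v) + (f zero + sumFin (λ u → if not ⌊ v ≟ u ⌋ then f (suc u) else + 0))
      ≡⟨ x∙yz≈y∙xz (f (suc v)) (f zero) _ ⟩
    f zero + closedSum (K n) (f ∘ suc) v
      ≡⟨ cong (_+_ (f zero)) (closedSum-K (f ∘ suc) v) ⟩
    f zero + sumFin (f ∘ suc) ∎
    where
    open ≡-Reasoning
    sumFin-cong : ∀ {m} {g h : Fin m → ℤ} → (∀ i → g i ≡ h i) → sumFin g ≡ sumFin h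
    sumFin-cong {zero}  g≗h = refl
    sumFin-cong {suc m} g≗h = cong₂ _+_ (g≗h zero) (sumFin-cong (g≗h ∘ suc))

  alternating : ℕ → ℤ
  alternating zero          = + 1
  alternating (suc zero)    = -[1+ 0 ]
  alternating (suc (suc j)) = alternating j

  alternating-±1 : ∀ j → alternating j ≡ + 1 ⊎ alternating j ≡ -[1+ 0 ]
  alternating-±1 zero          = inj₁ refl
  alternating-±1 (suc zero)    = inj₂ refl
  alternating-±1 (suc (suc j)) = alternating-±1 j

  ∑-alternating : ∀ m → sumFin {m} (alternating ∘ toℕ) ≡ + (m % 2)
  ∑-alternating zero          = refl
  ∑-alternating (suc zero)    = refl
  ∑-alternating (suc (suc m)) =
    trans (sym (+-assoc (+ 1) -[1+ 0 ] (sumFin {m} (alternating ∘ toℕ))))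
          (trans (+-identityˡ _) (∑-alternating m))

  sdf-K : ∀ {k} → Fin (suc k) → ℤ
  sdf-K zero    = + 1
  sdf-K (suc i) = alternating (toℕ i)

  sdf-K-±1 : ∀ {k} (v : Fin (suc k)) → sdf-K v ≡ + 1 ⊎ sdf-K v ≡ -[1+ 0 ]
  sdf-K-±1 zero    = inj₁ refl
  sdf-K-±1 (suc i) = alternating-±1 (toℕ i)

  weight-sdf-K : ∀ k → weight (K (suc k)) sdf-K ≡ + (1 ℕ.+ k % 2)
  weight-sdf-K k = cong (_+_ (+ 1)) (∑-alternating k)

  -- Any SDF f of K_{k+1} has f(N[0]) = w(f) ≥ 1, and w(f) ≡ k + 1 (mod 2).
  weight-K-≥ : ∀ k f → IsSDF (K (suc k)) f → + (1 ℕ.+ k % 2) ≤ weight (K (suc k)) f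
  weight-K-≥ k f sdf@(±1 , closedSum≥1) =
    subst (+ (1 ℕ.+ k % 2) ≤_) (sym w≡p-m) (k+n≤m⇒k≤m-n parity)
    where
    open SignedDominatingFunction (K (suc k)) f sdf using (positives; negatives; σ)
    w≡p-m : weight (K (suc k)) f ≡ + positives - + negatives
    w≡p-m = weight-signs f ±1
    size : suc k ≡ positives ℕ.+ negatives
    size = n≡countFin-not+countFin σ
    1+m≤p : suc negatives ℕ.≤ positives
    1+m≤p = k≤m-n⇒k+n≤m (subst (+ 1 ≤_) (trans (closedSum-K f zero) w≡p-m) (closedSum≥1 zero))
    parity : 1 ℕ.+ k % 2 ℕ.+ negatives ℕ.≤ positives
    parity = subst (λ r → suc (r ℕ.+ negatives) ℕ.≤ positives)
               (cong (_% 2) (trans (ℕ.+-suc positives negatives) (cong suc (sym size))))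
               (ℕ.≤-trans (ℕ.≤-reflexive (sym (ℕ.+-suc _ negatives))) (m≤n⇒[n+m]%2+m≤n 1+m≤p))

  signedDomNumber-K : ∀ k → IsSignedDomNumber (K (suc k)) (+ (1 ℕ.+ k % 2))
  signedDomNumber-K k = (sdf-K , sdf , weight-sdf-K k) , weight-K-≥ k
    where
    sdf : IsSDF (K (suc k)) sdf-K
    sdf = sdf-K-±1 , λ v →
      subst (+ 1 ≤_) (sym (trans (closedSum-K sdf-K v) (weight-sdf-K k))) (+≤+ (s≤s z≤n))

  sharp₁-identity : ∀ x → + (1 ℕ.+ x % 2) * + (⌈ x /2⌉ ℕ.+ ⌊ x /2⌋ ℕ.+ 1)
    ≡ ((+ ⌈ x /2⌉ - + ⌊ x /2⌋) + + 1) * + suc x + + (2 ℕ.* ⌊ x /2⌋ ℕ.* 0)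
  sharp₁-identity x = begin
    + (1 ℕ.+ r) * + (c ℕ.+ f ℕ.+ 1)                  ≡⟨ cong (λ y → + (1 ℕ.+ r) * + y) size ⟩
    + (1 ℕ.+ r) * + suc x                            ≡⟨ ring (+ f) (+ r) (+ suc x) ⟩
    ((+ (f ℕ.+ r) - + f) + + 1) * + suc x + + 0      ≡⟨ cong₂ (λ y z → ((+ y - + f) + + 1) * + suc x + + z)
                                                              (sym c≡f+r) (sym (ℕ.*-zeroʳ (2 ℕ.* f))) ⟩
    ((+ c - + f) + + 1) * + suc x + + (2 ℕ.* f ℕ.* 0) ∎
    where
    open ≡-Reasoning
    f c r : ℕ
    f = ⌊ x /2⌋
    c = ⌈ x /2⌉
    r = x % 2
    c≡f+r : c ≡ f ℕ.+ r
    c≡f+r = ⌈n/2⌉≡⌊n/2⌋+n%2 x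
    size : c ℕ.+ f ℕ.+ 1 ≡ suc x
    size = trans (cong (ℕ._+ 1) (trans (ℕ.+-comm c f) (ℕ.⌊n/2⌋+⌈n/2⌉≡n x))) (ℕ.+-comm x 1)
    ring : ∀ f r X → (+ 1 + r) * X ≡ (((f + r) - f) + + 1) * X + + 0
    ring = ℤ-Solver.solve-∀

  sharp₂-identity : ∀ x → + (1 ℕ.+ x % 2) * + (⌈ 3 ℕ.* x /2⌉ ℕ.+ ⌊ 3 ℕ.* x /2⌋ ℕ.+ 3)
    ≡ ((+ ⌈ 3 ℕ.* x /2⌉ - + ⌊ 3 ℕ.* x /2⌋) + + 3) * + suc x
      + + (2 ℕ.* (⌊ x /2⌋ ℕ.* 0 ℕ.+ suc x ℕ.* (x % 2)))
  sharp₂-identity x = begin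
    + (1 ℕ.+ r) * + (C ℕ.+ F ℕ.+ 3)                   ≡⟨ cong (λ y → + (1 ℕ.+ r) * + y) size ⟩
    + (1 ℕ.+ r) * + (3 ℕ.* suc x)                     ≡⟨ cong (_*_ (+ (1 ℕ.+ r))) (pos-* 3 (suc x)) ⟩
    + (1 ℕ.+ r) * (+ 3 * + suc x)                     ≡⟨ ring (+ F) (+ r) (+ suc x) ⟩
    ((+ (F ℕ.+ r) - + F) + + 3) * + suc x + + 2 * (+ suc x * + r)
                                                      ≡⟨ cong₂ (λ y z → ((+ y - + F) + + 3) * + suc x + z)
                                                               (sym C≡F+r) (sym odd) ⟩
    ((+ C - + F) + + 3) * + suc x + + (2 ℕ.* (⌊ x /2⌋ ℕ.* 0 ℕ.+ suc x ℕ.* r)) ∎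
    where
    open ≡-Reasoning
    F C r : ℕ
    F = ⌊ 3 ℕ.* x /2⌋
    C = ⌈ 3 ℕ.* x /2⌉
    r = x % 2
    C≡F+r : C ≡ F ℕ.+ r
    C≡F+r = trans (⌈n/2⌉≡⌊n/2⌋+n%2 (3 ℕ.* x)) (cong (F ℕ.+_) ([3n]%2≡n%2 x))
    size : C ℕ.+ F ℕ.+ 3 ≡ 3 ℕ.* suc x
    size = trans (cong (ℕ._+ 3) (trans (ℕ.+-comm C F) (ℕ.⌊n/2⌋+⌈n/2⌉≡n (3 ℕ.* x))))
                 (trans (ℕ.+-comm (3 ℕ.* x) 3) (sym (ℕ.*-suc 3 x)))
    odd : + (2 ℕ.* (⌊ x /2⌋ ℕ.* 0 ℕ.+ suc x ℕ.* r)) ≡ + 2 * (+ suc x * + r)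
    odd = trans (cong (λ y → + (2 ℕ.* (y ℕ.+ suc x ℕ.* r))) (ℕ.*-zeroʳ ⌊ x /2⌋))
                (trans (pos-* 2 (suc x ℕ.* r)) (cong (_*_ (+ 2)) (pos-* (suc x) r)))
    ring : ∀ f r X → (+ 1 + r) * (+ 3 * X) ≡ (((f + r) - f) + + 3) * X + + 2 * (X * r)
    ring = ℤ-Solver.solve-∀

  sharp₁-K : ∀ k → + (1 ℕ.+ k % 2) * + den1 (K (3 ℕ.+ k)) (2 ℕ.+ k) ≡ num1 (K (3 ℕ.+ k)) (2 ℕ.+ k)
  sharp₁-K k rewrite maxDeg-K (2 ℕ.+ k) | numLeaves-K k = sharp₁-identity (2 ℕ.+ k)

  sharp₂-K : ∀ k → + (1 ℕ.+ k % 2) * + den2 (K (3 ℕ.+ k)) (2 ℕ.+ k) ≡ num2 (K (3 ℕ.+ k)) (2 ℕ.+ k)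
  sharp₂-K k rewrite maxDeg-K (2 ℕ.+ k) | numLeaves-K k | numOdd-K (2 ℕ.+ k) = sharp₂-identity (2 ℕ.+ k)

open CompleteGraph

open import Data.Nat using (_≥_)
open Int using (+_; _*_; _≤_)

lowerBounds : ∀ {n} (G : Graph n) f → IsSDF G f → ∀ d → (∀ v → InC G v → d ℕ.≤ deg G v) →
  (num1 G d ≤ weight G f * + den1 G d) × (num2 G d ≤ weight G f * + den2 G d)
lowerBounds {n} G f sdf d d≤deg =
  subst (λ w → num1 G d ≤ w * + den1 G d) (sym weight≡)
    (counting⇒bound₁ ⌈ d /2⌉ b positives negatives ℓ size (counting₁ d d≤deg)) ,
  subst (λ w → num2 G d ≤ w * + den2 G d) (sym weight≡)
    (counting⇒bound₂ ⌈ 3 ℕ.* d /2⌉ ⌊ 3 ℕ.* maxDeg G /2⌋ b positives negatives ℓ (numOdd G) size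
                     (counting₂ d d≤deg))
  where
  open SignedDominatingFunction G f sdf
  b ℓ : ℕ
  b = ⌊ maxDeg G /2⌋
  ℓ = numLeaves G
  size : n ≡ positives ℕ.+ negatives
  size = n≡countFin-not+countFin σ
  weight≡ : weight G f ≡ + positives Int.- + negatives
  weight≡ = weight-signs f (proj₁ sdf)

completeGraph-sharp : ∀ k → let n = 3 ℕ.+ k in ∃ λ d → ∃ λ γ →
  IsDeltaStar (K n) d × IsSignedDomNumber (K n) γ ×
  (γ * + den1 (K n) d ≡ num1 (K n) d) × (γ * + den2 (K n) d ≡ num2 (K n) d)
completeGraph-sharp k =
  2 ℕ.+ k , + (1 ℕ.+ k % 2) , δ*-K k , signedDomNumber-K (2 ℕ.+ k) , sharp₁-K k , sharp₂-K k

theorem3p2 : (∀ (n : ℕ) (G : Graph n) → Connected G → ∃ (λ v → InC G v) →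
    ∀ (d : ℕ) (γ : ℤ) → IsDeltaStar G d → IsSignedDomNumber G γ →
    (num1 G d ≤ γ * + den1 G d) × (num2 G d ≤ γ * + den2 G d))
    ×
    (∀ (n : ℕ) → n ≥ 3 →
    ∃ λ (d : ℕ) → ∃ λ (γ : ℤ) →
    IsDeltaStar (K n) d × IsSignedDomNumber (K n) γ ×
    (γ * + den1 (K n) d ≡ num1 (K n) d) × (γ * + den2 (K n) d ≡ num2 (K n) d))
theorem3p2 =
  (λ { n G _ _ d γ (_ , d≤deg) ((f , sdf , refl) , _) → lowerBounds G f sdf d d≤deg }) ,
  (λ { (suc (suc (suc k))) (s≤s (s≤s (s≤s _))) → completeGraph-sharp k })
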